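{- Let $\gamma\in\mathrm{Clan}_{p,q}$ and $1\le i<n$. (a) If $\gamma\ast s_i$ is defined, then $\iota(\gamma\ast s_i)=\iota(\gamma)\ast s_i$. (b) If $\gamma\ast s_i<\gamma$ in clan weak order, then $\iota(\gamma\ast s_i)>\iota(\gamma)$ in involution weak order. (c) Suppose $i$ is a descent of $\iota(\gamma)$, i.e. $\iota(\gamma)(i)>\iota(\gamma)(i+1)$. If $\iota(\gamma)\ast s_i=s_i\iota(\gamma)s_i$, there is a unique $\gamma'\in\mathrm{Clan}_{p,q}$ with $\gamma'>\gamma$ and $\gamma'\ast s_i=\gamma$; if $\iota(\gamma)\ast s_i=\iota(\gamma)s_i$, there are exactly two such $\gamma'$. (d) The map $\iota:\mathrm{Clan}_{p,q}\to\mathcal I_n$ is order-reversing (from clan weak order to involution weak order) and its image is $\mathcal I_{p,q}$.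
   Context: Fix integers $p,q\ge0$, $n=p+q$, $[n]=\{1,\dots,n\}$. A $(p,q)$-clan is an involution $\gamma$ of $[n]$ each of whose fixed points is labelled $+$ or $-$, with (number of $+$) $-$ (number of $-$) $=p-q$; $\mathrm{Clan}_{p,q}$ is the set of these, $\iota(\gamma)\in S_n$ the underlying involution, and $i\neq j$ are matched if $\iota(\gamma)(i)=j$. Let $s_i=(i\;i{+}1)$ and $\ell(w)$ the number of inversions of $w\in S_n$. For $1\le i<n$, $s_i\gamma s_i$ is the clan with underlying involution $s_i\iota(\gamma)s_i$, fixed points keeping their signs except that the signs of $i,i+1$ (when fixed) become those of $i+1,i$ in $\gamma$. The partial operation $\gamma\ast s_i$: if $i,i+1$ are fixed points of opposite sign, $\gamma\ast s_i$ is $\gamma$ with $i,i+1$ matched; if $i,i+1$ are matched to each other or fixed of equal sign, undefined; otherwise $\gamma\ast s_i=s_i\gamma s_i$. Clan weak order on $\mathrm{Clan}_{p,q}$: transitive closure of $\gamma\ast s_i<\gamma$ whenever $\gamma\ast s_i$ is defined and $\ell(\iota(\gamma\ast s_i))>\ell(\iota(\gamma))$. Let $\mathcal I_n$ be the set of involutions in $S_n$; for $z\in\mathcal I_n$, $z\ast s_i=zs_i$ if $s_iz=zs_i$ and $z\ast s_i=s_izs_i$ otherwise. Involution weak order on $\mathcal I_n$: transitive closure of $z\ast s_i<z$ whenever $\ell(z\ast s_i)<\ell(z)$. $\kappa(z)$ is the number of 2-cycles of $z$, and $\mathcal I_{p,q}=\{z\in\mathcal I_n:\kappa(z)\le\min(p,q)\}$.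 -}

module Defs where

open import Data.Nat using (ℕ; zero; suc; _+_; _∸_; _≤_; _<_)
open import Data.Nat.Properties using (m∸n≤m; ≤-<-trans)
open import Data.Fin as F using (Fin; toℕ; fromℕ<; _≟_)
open import Data.Vec as V using (Vec; []; _∷_; lookup; tabulate; _[_]≔_)
open import Data.Vec.Properties using (≡-dec)
open import Data.List as L using (List; length; filter; allFin)
open import Data.Nat.ListAction using (sum)
open import Data.Bool using (Bool; true; false; if_then_else_)
open import Data.Maybe using (Maybe; just; nothing)
open import Data.Product using (Σ; ∃; _×_; _,_)
open import Relation.Nullary using (¬_; Dec; yes; no; does)
open import Relation.Nullary.Decidable using (_×-dec_)
open import Relation.Binary.PropositionalEquality using (_≡_; refl)
open import Relation.Binary.Construct.Closure.Transitive using (TransClosure)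

-- Conventions: the set [n] = {1,…,n} is represented by Fin n, where
-- the element k : Fin n stands for k+1 ∈ [n].  Permutations of [n]
-- are vectors of their values (one-line notation).

Perm : ℕ → Set
Perm n = Vec (Fin n) n

IsInvolution : ∀ {n} → Perm n → Set
IsInvolution {n} z = ∀ (x : Fin n) → lookup z (lookup z x) ≡ x

ℓ : ∀ {n} → Perm n → ℕ
ℓ {n} w = sum (L.map (λ x → length (filter (λ y → (x F.<? y) ×-dec (lookup w y F.<? lookup w x)) (allFin n))) (allFin n))

-- κ(z): number of 2-cycles of z = number of x with x < z(x)
κ : ∀ {n} → Perm n → ℕ
κ {n} z = length (filter (λ x → x F.<? lookup z x) (allFin n))

-- Simple transpositions s_i, 1 ≤ i < n (paper indexing).

Idx : ℕ → Set
Idx n = Σ ℕ λ i → (1 ≤ i) × (i < n)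

-- the positions i and i+1 of [n], as elements of Fin n
lo hi : ∀ {n} → Idx n → Fin n
lo (i , _ , h) = fromℕ< (≤-<-trans (m∸n≤m i 1) h)
hi (i , _ , h) = fromℕ< h

swap : ∀ {n} → Fin n → Fin n → Fin n → Fin n
swap a b x with does (x ≟ a)
... | true = b
... | false with does (x ≟ b)
...   | true = a
...   | false = x

s : ∀ {n} → Idx n → Fin n → Fin n
s i = swap (lo i) (hi i)

rmul : ∀ {n} → Perm n → Idx n → Perm n
rmul z i = tabulate λ x → lookup z (s i x)

lmul : ∀ {n} → Idx n → Perm n → Perm n
lmul i z = tabulate λ x → s i (lookup z x)

conjP : ∀ {n} → Idx n → Perm n → Perm n
conjP i z = tabulate λ x → s i (lookup z (s i x))

_∗ᴵ_ : ∀ {n} → Perm n → Idx n → Perm n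
z ∗ᴵ i = if does (≡-dec _≟_ (lmul i z) (rmul z i)) then rmul z i else conjP i z

InvCover : ∀ {n} → Perm n → Perm n → Set
InvCover {n} w z = Σ (Idx n) λ i → (z ∗ᴵ i ≡ w) × (ℓ w < ℓ z)

_<ᴵ_ : ∀ {n} → Perm n → Perm n → Set
_<ᴵ_ = TransClosure InvCover

-- Clans.  A clan on [n] is stored as a vector of entries: position x
-- carries either a sign (x is a fixed point with that sign) or the
-- point it is matched with.

data Sign : Set where
  plus minus : Sign

_≟ˢ_ : (a b : Sign) → Dec (a ≡ b)
plus ≟ˢ plus = yes refl
plus ≟ˢ minus = no λ ()
minus ≟ˢ plus = no λ ()
minus ≟ˢ minus = yes refl

data Entry (n : ℕ) : Set where
  fx : Sign → Entry n
  mt : Fin n → Entry n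

RawClan : ℕ → Set
RawClan n = Vec (Entry n) n

countSign : ∀ {n m} → Sign → Vec (Entry n) m → ℕ
countSign σ [] = 0
countSign σ (fx τ ∷ v) = (if does (σ ≟ˢ τ) then 1 else 0) + countSign σ v
countSign σ (mt _ ∷ v) = countSign σ v

-- γ ∈ Clan_{p,q}: the matching is an involution without "self-matches",
-- and (#plus) − (#minus) = p − q  (stated additively in ℕ)
IsClan : (p q : ℕ) → RawClan (p + q) → Set
IsClan p q γ =
  (∀ (x j : Fin (p + q)) → lookup γ x ≡ mt j → (¬ (j ≡ x)) × (lookup γ j ≡ mt x))
  × (countSign plus γ + q ≡ countSign minus γ + p)

ι : ∀ {n} → RawClan n → Perm n
ι γ = tabulate λ x → img x (lookup γ x)
  where
  img : ∀ {n} → Fin n → Entry n → Fin n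
  img x (fx _) = x
  img x (mt j) = j

conjC : ∀ {n} → Idx n → RawClan n → RawClan n
conjC i γ = tabulate λ x → relab (lookup γ (s i x))
  where
  relab : Entry _ → Entry _
  relab (fx σ) = fx σ
  relab (mt j) = mt (s i j)

starC : ∀ {n} → RawClan n → Idx n → Entry n → Entry n → Maybe (RawClan n)
starC γ i (fx a) (fx b) with does (a ≟ˢ b)
... | true = nothing
... | false = just ((γ [ lo i ]≔ mt (hi i)) [ hi i ]≔ mt (lo i))
starC γ i (fx a) (mt _) = just (conjC i γ)
starC γ i (mt j) _ with does (j ≟ hi i)
... | true = nothing
... | false = just (conjC i γ)

_∗ᶜ_ : ∀ {n} → RawClan n → Idx n → Maybe (RawClan n)
γ ∗ᶜ i = starC γ i (lookup γ (lo i)) (lookup γ (hi i))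

ClanCover : ∀ {n} → RawClan n → RawClan n → Set
ClanCover {n} δ γ = Σ (Idx n) λ i → (γ ∗ᶜ i ≡ just δ) × (ℓ (ι γ) < ℓ (ι δ))

_<ᶜ_ : ∀ {n} → RawClan n → RawClan n → Set
_<ᶜ_ = TransClosure ClanCover

module Submission where

-- Everything reduces to the local picture at the positions i, i+1.  A matching γ
-- is either closed there (i, i+1 both fixed, or matched with each other) or generic
-- (one of them is matched outside the pair).  In the closed case ι(γ) commutes with
-- s_i and γ ∗ s_i, when defined, joins the pair, turning ι(γ) into ι(γ) s_i; in the
-- generic case ι(γ) does not commute with s_i and γ ∗ s_i = s_i γ s_i has involution
-- s_i ι(γ) s_i.  This is (a); (b) follows since ∗ s_i is an involution on involutions,
-- and the order reversal in (d) by induction along chains, clans being preserved by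
-- ∗ s_i.  For (c), a descent rules out two fixed points; a generic γ has the single
-- cover s_i γ s_i and a paired γ the two splittings into opposite signs.  For the image in (d): a clan has
-- #fixed + 2κ = p + q and #plus − #minus = p − q, whence κ ≤ min(p, q); conversely,
-- signing p − κ fixed points of an involution + and the others − yields a clan.

open import Defs
open import Data.Nat using (ℕ; _+_; _≤_; _⊓_)
open import Data.Fin using (Fin) renaming (_<_ to _<ꟳ_)
open import Data.Vec using (lookup)
open import Data.Maybe using (just)
open import Data.Product using (Σ; ∃; _×_; _,_)
open import Data.Sum using (_⊎_)
open import Function.Bundles using (_⇔_)
open import Relation.Nullary using (¬_)
open import Relation.Binary.PropositionalEquality using (_≡_)

open import Data.Nat as ℕ using (zero; suc; _∸_; _<_; z≤n; s≤s)
import Data.Nat.Properties as ℕP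
open import Data.Nat.Tactic.RingSolver using (solve-∀)
open import Data.Fin as F using (toℕ; _≟_)
import Data.Fin.Properties as FP
import Data.Fin.Permutation as Perm
open import Data.Vec using (Vec; []; _∷_; tabulate; _[_]≔_)
open import Data.Vec.Properties using (lookup∘tabulate; tabulate∘lookup; tabulate-cong; lookup∘update; lookup∘update′; ≡-dec)
import Data.List as L
import Data.Nat.ListAction as LA
open import Data.Bool using (Bool; true; false; if_then_else_)
open import Data.Maybe.Properties using (just-injective)
open import Data.Product using (proj₁; proj₂)
open import Data.Sum using (inj₁; inj₂)
open import Data.Empty using (⊥; ⊥-elim)
open import Function.Bundles using (mk⇔)
open import Relation.Nullary using (Dec; yes; no; does)
open import Relation.Nullary.Decidable using (_×-dec_; map′)
open import Relation.Binary.Definitions using (tri<; tri≈; tri>)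
open import Relation.Binary.PropositionalEquality
  using (_≢_; refl; sym; trans; cong; cong₂; subst; subst₂; module ≡-Reasoning)
open import Relation.Binary.Construct.Closure.Transitive using ([_]; _∷_; _++_)
open import Algebra.Properties.CommutativeMonoid.Sum ℕP.+-0-commutativeMonoid
  using (sum; sum-cong-≗; ∑-distrib-+; sum-permute)

module _ {n : ℕ} where

  swap-left : (a b : Fin n) → swap a b a ≡ b
  swap-left a b with a ≟ a
  ... | yes _ = refl
  ... | no a≢a = ⊥-elim (a≢a refl)

  swap-right : (a b : Fin n) → a ≢ b → swap a b b ≡ a
  swap-right a b a≢b with b ≟ a
  ... | yes b≡a = ⊥-elim (a≢b (sym b≡a))
  ... | no _ with b ≟ b
  ...   | yes _ = refl
  ...   | no b≢b = ⊥-elim (b≢b refl)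

  swap-other : (a b x : Fin n) → x ≢ a → x ≢ b → swap a b x ≡ x
  swap-other a b x x≢a x≢b with x ≟ a
  ... | yes x≡a = ⊥-elim (x≢a x≡a)
  ... | no _ with x ≟ b
  ...   | yes x≡b = ⊥-elim (x≢b x≡b)
  ...   | no _ = refl

toℕ-hi : ∀ {n} (i : Idx n) → toℕ (hi i) ≡ suc (toℕ (lo i))
toℕ-hi (suc k , s≤s z≤n , k<n) = trans (FP.toℕ-fromℕ< k<n) (cong suc (sym (FP.toℕ-fromℕ< _)))

module _ {n : ℕ} (i : Idx n) where

  lo<hi : lo i <ꟳ hi i
  lo<hi = ℕP.≤-reflexive (sym (toℕ-hi i))

  lo≢hi : lo i ≢ hi i
  lo≢hi lo≡hi = FP.<-irrefl lo≡hi lo<hi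

  s-lo : s i (lo i) ≡ hi i
  s-lo = swap-left (lo i) (hi i)

  s-hi : s i (hi i) ≡ lo i
  s-hi = swap-right (lo i) (hi i) lo≢hi

  s-other : ∀ x → x ≢ lo i → x ≢ hi i → s i x ≡ x
  s-other = swap-other (lo i) (hi i)

  data Position (x : Fin n) : Set where
    at-lo : x ≡ lo i → Position x
    at-hi : x ≡ hi i → Position x
    away  : x ≢ lo i → x ≢ hi i → Position x

  position : ∀ x → Position x
  position x with x ≟ lo i | x ≟ hi i
  ... | yes x≡lo | _ = at-lo x≡lo
  ... | no _ | yes x≡hi = at-hi x≡hi
  ... | no x≢lo | no x≢hi = away x≢lo x≢hi

  s-involutive : ∀ x → s i (s i x) ≡ x
  s-involutive x with position x
  ... | at-lo refl = trans (cong (s i) s-lo) s-hi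
  ... | at-hi refl = trans (cong (s i) s-hi) s-lo
  ... | away x≢lo x≢hi = trans (cong (s i) (s-other x x≢lo x≢hi)) (s-other x x≢lo x≢hi)

  s-injective : ∀ {x y} → s i x ≡ s i y → x ≡ y
  s-injective {x} {y} eq = trans (sym (s-involutive x)) (trans (cong (s i) eq) (s-involutive y))

  s-monotone : ∀ {x y} → x <ꟳ y → ¬ (x ≡ lo i × y ≡ hi i) → s i x <ꟳ s i y
  s-monotone {x} {y} x<y not-pair with position x | position y
  ... | at-lo refl | at-lo refl = ⊥-elim (FP.<-irrefl refl x<y)
  ... | at-lo refl | at-hi refl = ⊥-elim (not-pair (refl , refl))
  ... | at-lo refl | away y≢lo y≢hi
    rewrite s-lo | s-other y y≢lo y≢hi = ℕP.≤∧≢⇒< (subst (ℕ._≤ toℕ y) (sym (toℕ-hi i)) x<y) (λ e → y≢hi (FP.toℕ-injective (sym e)))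
  ... | at-hi refl | at-lo refl = ⊥-elim (FP.<-asym x<y lo<hi)
  ... | at-hi refl | at-hi refl = ⊥-elim (FP.<-irrefl refl x<y)
  ... | at-hi refl | away y≢lo y≢hi
    rewrite s-hi | s-other y y≢lo y≢hi = FP.<-trans lo<hi x<y
  ... | away x≢lo x≢hi | at-lo refl
    rewrite s-lo | s-other x x≢lo x≢hi = FP.<-trans x<y lo<hi
  ... | away x≢lo x≢hi | at-hi refl
    rewrite s-hi | s-other x x≢lo x≢hi = ℕP.≤∧≢⇒< (ℕP.≤-pred (subst (suc (toℕ x) ℕ.≤_) (toℕ-hi i) x<y)) (λ e → x≢lo (FP.toℕ-injective e))
  ... | away x≢lo x≢hi | away y≢lo y≢hi
    rewrite s-other x x≢lo x≢hi | s-other y y≢lo y≢hi = x<y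

𝟙 : Bool → ℕ
𝟙 true = 1
𝟙 false = 0

module _ {A B : Set} where

  𝟙-mono : (a? : Dec A) (b? : Dec B) → (A → B) → 𝟙 (does a?) ≤ 𝟙 (does b?)
  𝟙-mono (yes a) (yes _) _ = ℕP.≤-refl
  𝟙-mono (yes a) (no ¬b) a→b = ⊥-elim (¬b (a→b a))
  𝟙-mono (no _) _ _ = z≤n

  𝟙-strict : (a? : Dec A) (b? : Dec B) → ¬ A → B → 𝟙 (does a?) < 𝟙 (does b?)
  𝟙-strict (yes a) _ ¬a _ = ⊥-elim (¬a a)
  𝟙-strict (no _) (yes _) _ _ = ℕP.≤-refl
  𝟙-strict (no _) (no ¬b) _ b = ⊥-elim (¬b b)

module _ {A : Set} where

  𝟙-yes : (a? : Dec A) → A → 𝟙 (does a?) ≡ 1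
  𝟙-yes (yes _) _ = refl
  𝟙-yes (no ¬a) a = ⊥-elim (¬a a)

  𝟙-no : (a? : Dec A) → ¬ A → 𝟙 (does a?) ≡ 0
  𝟙-no (yes a) ¬a = ⊥-elim (¬a a)
  𝟙-no (no _) _ = refl

sum-involution : ∀ {n} (f : Fin n → Fin n) → (∀ x → f (f x) ≡ x) → (g : Fin n → ℕ) → sum (λ x → g (f x)) ≡ sum g
sum-involution f f-inv g = sym (sum-permute g (Perm.permutation f f f-inv f-inv))

sum-mono : ∀ {n} {f g : Fin n → ℕ} → (∀ x → f x ≤ g x) → sum f ≤ sum g
sum-mono {zero} f≤g = z≤n
sum-mono {suc n} f≤g = ℕP.+-mono-≤ (f≤g F.zero) (sum-mono (λ x → f≤g (F.suc x)))

sum-mono-< : ∀ {n} {f g : Fin n → ℕ} → (∀ x → f x ≤ g x) → (a : Fin n) → f a < g a → sum f < sum g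
sum-mono-< {suc n} f≤g F.zero fa<ga = ℕP.+-mono-<-≤ fa<ga (sum-mono (λ x → f≤g (F.suc x)))
sum-mono-< {suc n} f≤g (F.suc a) fa<ga = ℕP.+-mono-≤-< (f≤g F.zero) (sum-mono-< (λ x → f≤g (F.suc x)) a fa<ga)

sum-ones : ∀ n → sum {n} (λ _ → 1) ≡ n
sum-ones zero = refl
sum-ones (suc n) = cong suc (sum-ones n)

sum-map-tabulate : ∀ {m} {A : Set} (f : Fin m → A) (h : A → ℕ) → LA.sum (L.map h (L.tabulate f)) ≡ sum (λ x → h (f x))
sum-map-tabulate {zero} f h = refl
sum-map-tabulate {suc m} f h = cong (h (f F.zero) +_) (sum-map-tabulate (λ x → f (F.suc x)) h)

length-filter-tabulate : ∀ {m} {A : Set} {P : A → Set} (f : Fin m → A) (P? : (a : A) → Dec (P a)) →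
  L.length (L.filter P? (L.tabulate f)) ≡ sum (λ x → 𝟙 (does (P? (f x))))
length-filter-tabulate {zero} f P? = refl
length-filter-tabulate {suc m} f P? with does (P? (f F.zero))
... | true = cong suc (length-filter-tabulate (λ x → f (F.suc x)) P?)
... | false = length-filter-tabulate (λ x → f (F.suc x)) P?

Inversion : ∀ {n} → Perm n → Fin n → Fin n → Set
Inversion w x y = (x <ꟳ y) × (lookup w y <ꟳ lookup w x)

inversion? : ∀ {n} (w : Perm n) x y → Dec (Inversion w x y)
inversion? w x y = (x F.<? y) ×-dec (lookup w y F.<? lookup w x)

ℓ-sum : ∀ {n} (w : Perm n) → ℓ w ≡ sum (λ x → sum (λ y → 𝟙 (does (inversion? w x y))))
ℓ-sum {n} w = trans (sum-map-tabulate {n} (λ x → x) (λ x → L.length (L.filter (inversion? w x) (L.allFin n)))) (sum-cong-≗ (λ x → length-filter-tabulate (λ y → y) (inversion? w x)))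

module InversionComparison {n} (w w′ : Perm n) (f : Fin n → Fin n) (f-inv : ∀ x → f (f x) ≡ x)
  (transport : ∀ x y → Inversion w′ (f x) (f y) → Inversion w x y) where

  private
    count′ count : Fin n → Fin n → ℕ
    count′ x y = 𝟙 (does (inversion? w′ (f x) (f y)))
    count x y = 𝟙 (does (inversion? w x y))

    ℓ-reindexed : ℓ w′ ≡ sum (λ x → sum (count′ x))
    ℓ-reindexed = trans (ℓ-sum w′)
      (trans (sym (sum-involution f f-inv (λ x → sum (λ y → 𝟙 (does (inversion? w′ x y))))))
             (sum-cong-≗ (λ x → sym (sum-involution f f-inv (λ y → 𝟙 (does (inversion? w′ (f x) y)))))))

    count′≤count : ∀ x y → count′ x y ≤ count x y
    count′≤count x y = 𝟙-mono (inversion? w′ (f x) (f y)) (inversion? w x y) (transport x y)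

  ℓ-≤ : ℓ w′ ≤ ℓ w
  ℓ-≤ = begin
      ℓ w′                        ≡⟨ ℓ-reindexed ⟩
      sum (λ x → sum (count′ x))  ≤⟨ sum-mono (λ x → sum-mono (count′≤count x)) ⟩
      sum (λ x → sum (count x))   ≡⟨ sym (ℓ-sum w) ⟩
      ℓ w                         ∎
    where open ℕP.≤-Reasoning

  ℓ-< : ∀ a b → ¬ Inversion w′ (f a) (f b) → Inversion w a b → ℓ w′ < ℓ w
  ℓ-< a b missed inv = begin-strict
      ℓ w′                        ≡⟨ ℓ-reindexed ⟩
      sum (λ x → sum (count′ x))  <⟨ sum-mono-< (λ x → sum-mono (count′≤count x)) a
                                       (sum-mono-< (count′≤count a) b (𝟙-strict (inversion? w′ (f a) (f b)) (inversion? w a b) missed inv)) ⟩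
      sum (λ x → sum (count x))   ≡⟨ sym (ℓ-sum w) ⟩
      ℓ w                         ∎
    where open ℕP.≤-Reasoning

module _ {n : ℕ} (i : Idx n) where

  lookup-rmul : ∀ (w : Perm n) x → lookup (rmul w i) x ≡ lookup w (s i x)
  lookup-rmul w x = lookup∘tabulate _ x

  lookup-lmul : ∀ (w : Perm n) x → lookup (lmul i w) x ≡ s i (lookup w x)
  lookup-lmul w x = lookup∘tabulate _ x

  lookup-conjP : ∀ (w : Perm n) x → lookup (conjP i w) x ≡ s i (lookup w (s i x))
  lookup-conjP w x = lookup∘tabulate _ x

  Descent : Perm n → Set
  Descent w = lookup w (hi i) <ꟳ lookup w (lo i)

  -- right multiplication by s_i at a descent removes exactly one inversion
  ℓ-rmul-< : (w : Perm n) → Descent w → ℓ (rmul w i) < ℓ w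
  ℓ-rmul-< w desc = ℓ-< (lo i) (hi i) missed (lo<hi i , desc)
    where
    ws≡w : ∀ x → lookup (rmul w i) (s i x) ≡ lookup w x
    ws≡w x = trans (lookup-rmul w (s i x)) (cong (lookup w) (s-involutive i x))

    ascent-at-pair : ∀ {x y} → s i x ≡ lo i → s i y ≡ hi i → ¬ (lookup w y <ꟳ lookup w x)
    ascent-at-pair {x} {y} sx≡lo sy≡hi =
      subst₂ (λ u v → ¬ (lookup w v <ꟳ lookup w u))
        (sym (trans (sym (s-involutive i x)) (trans (cong (s i) sx≡lo) (s-lo i))))
        (sym (trans (sym (s-involutive i y)) (trans (cong (s i) sy≡hi) (s-hi i))))
        (FP.<-asym desc)

    transport : ∀ x y → Inversion (rmul w i) (s i x) (s i y) → Inversion w x y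
    transport x y (sx<sy , wy<wx) rewrite ws≡w x | ws≡w y =
      subst₂ _<ꟳ_ (s-involutive i x) (s-involutive i y)
        (s-monotone i sx<sy (λ (sx≡lo , sy≡hi) → ascent-at-pair sx≡lo sy≡hi wy<wx))
      , wy<wx

    open InversionComparison w (rmul w i) (s i) (s-involutive i) transport

    missed : ¬ Inversion (rmul w i) (s i (lo i)) (s i (hi i))
    missed (slo<shi , _) = FP.<-asym (lo<hi i) (subst₂ _<ꟳ_ (s-lo i) (s-hi i) slo<shi)

  ℓ-lmul-≤ : (w : Perm n) → (∀ x y → x <ꟳ y → lookup w x ≡ lo i → lookup w y ≢ hi i) → ℓ (lmul i w) ≤ ℓ w
  ℓ-lmul-≤ w no-pair = ℓ-≤
    where
    transport : ∀ x y → Inversion (lmul i w) x y → Inversion w x y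
    transport x y (x<y , swy<swx) rewrite lookup-lmul w x | lookup-lmul w y
      with FP.<-cmp (lookup w y) (lookup w x)
    ... | tri< wy<wx _ _ = x<y , wy<wx
    ... | tri≈ _ wy≡wx _ = ⊥-elim (FP.<-irrefl (cong (s i) wy≡wx) swy<swx)
    ... | tri> _ _ wx<wy = ⊥-elim (FP.<-asym swy<swx
            (s-monotone i wx<wy (λ (wx≡lo , wy≡hi) → no-pair x y x<y wx≡lo wy≡hi)))

    open InversionComparison w (lmul i w) (λ x → x) (λ _ → refl) transport

  ℓ-conjP-< : (z : Perm n) → IsInvolution z → Descent z → s i (lookup z (hi i)) ≢ lookup z (lo i) →
    ℓ (conjP i z) < ℓ z
  ℓ-conjP-< z z-inv desc twisted = begin-strict
      ℓ (conjP i z)         ≡⟨ cong ℓ conjP≡lmul-rmul ⟩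
      ℓ (lmul i (rmul z i)) ≤⟨ ℓ-lmul-≤ (rmul z i) no-pair ⟩
      ℓ (rmul z i)          <⟨ ℓ-rmul-< z desc ⟩
      ℓ z                   ∎
    where
    open ℕP.≤-Reasoning

    conjP≡lmul-rmul : conjP i z ≡ lmul i (rmul z i)
    conjP≡lmul-rmul = tabulate-cong (λ x → cong (s i) (sym (lookup-rmul z x)))

    preimage : ∀ x a → lookup (rmul z i) x ≡ a → x ≡ s i (lookup z a)
    preimage x a zsx≡a = trans (sym (s-involutive i x)) (cong (s i) (trans (sym (z-inv (s i x)))
      (cong (lookup z) (trans (sym (lookup-rmul z x)) zsx≡a))))

    no-pair : ∀ x y → x <ꟳ y → lookup (rmul z i) x ≡ lo i → lookup (rmul z i) y ≢ hi i
    no-pair x y x<y x↦lo y↦hi rewrite preimage x _ x↦lo | preimage y _ y↦hi =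
      FP.<-asym x<y (s-monotone i desc (λ (zhi≡lo , zlo≡hi) →
        twisted (trans (cong (s i) zhi≡lo) (trans (s-lo i) (sym zlo≡hi)))))

module _ {n : ℕ} (i : Idx n) where

  Commutes : Perm n → Set
  Commutes z = ∀ x → s i (lookup z x) ≡ lookup z (s i x)

  commutes⇒lmul≡rmul : ∀ z → Commutes z → lmul i z ≡ rmul z i
  commutes⇒lmul≡rmul z = tabulate-cong

  lmul≡rmul⇒commutes : ∀ z → lmul i z ≡ rmul z i → Commutes z
  lmul≡rmul⇒commutes z eq x =
    trans (sym (lookup-lmul i z x)) (trans (cong (λ v → lookup v x) eq) (lookup-rmul i z x))

  commutes? : ∀ z → Dec (Commutes z)
  commutes? z = map′ (lmul≡rmul⇒commutes z) (commutes⇒lmul≡rmul z) (≡-dec _≟_ (lmul i z) (rmul z i))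

  ∗ᴵ-commuting : ∀ z → Commutes z → z ∗ᴵ i ≡ rmul z i
  ∗ᴵ-commuting z c with ≡-dec _≟_ (lmul i z) (rmul z i)
  ... | yes _ = refl
  ... | no lmul≢rmul = ⊥-elim (lmul≢rmul (commutes⇒lmul≡rmul z c))

  ∗ᴵ-non-commuting : ∀ z → ¬ Commutes z → z ∗ᴵ i ≡ conjP i z
  ∗ᴵ-non-commuting z ¬c with ≡-dec _≟_ (lmul i z) (rmul z i)
  ... | yes eq = ⊥-elim (¬c (lmul≡rmul⇒commutes z eq))
  ... | no _ = refl

  rmul-involutive : ∀ z → rmul (rmul z i) i ≡ z
  rmul-involutive z = trans
    (tabulate-cong (λ x → trans (lookup-rmul i z (s i x)) (cong (lookup z) (s-involutive i x))))
    (tabulate∘lookup z)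

  conjP-involutive : ∀ z → conjP i (conjP i z) ≡ z
  conjP-involutive z = trans
    (tabulate-cong (λ x → trans (cong (s i) (lookup-conjP i z (s i x)))
                                 (trans (s-involutive i _) (cong (lookup z) (s-involutive i x)))))
    (tabulate∘lookup z)

  rmul-commutes : ∀ z → Commutes z → Commutes (rmul z i)
  rmul-commutes z c x =
    trans (cong (s i) (lookup-rmul i z x)) (trans (c (s i x)) (sym (lookup-rmul i z (s i x))))

  conjP-commutes⇒commutes : ∀ z → Commutes (conjP i z) → Commutes z
  conjP-commutes⇒commutes z c x = sym (begin
      lookup z (s i x)                  ≡⟨ sym (s-involutive i _) ⟩
      s i (s i (lookup z (s i x)))      ≡⟨ cong (s i) (sym (lookup-conjP i z x)) ⟩
      s i (lookup (conjP i z) x)        ≡⟨ c x ⟩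
      lookup (conjP i z) (s i x)        ≡⟨ lookup-conjP i z (s i x) ⟩
      s i (lookup z (s i (s i x)))      ≡⟨ cong (λ u → s i (lookup z u)) (s-involutive i x) ⟩
      s i (lookup z x)                  ∎)
    where open ≡-Reasoning

  ∗ᴵ-involutive : ∀ z → (z ∗ᴵ i) ∗ᴵ i ≡ z
  ∗ᴵ-involutive z with commutes? z
  ... | yes c = begin
      (z ∗ᴵ i) ∗ᴵ i       ≡⟨ cong (_∗ᴵ i) (∗ᴵ-commuting z c) ⟩
      rmul z i ∗ᴵ i       ≡⟨ ∗ᴵ-commuting (rmul z i) (rmul-commutes z c) ⟩
      rmul (rmul z i) i   ≡⟨ rmul-involutive z ⟩
      z                   ∎
    where open ≡-Reasoning
  ... | no ¬c = begin
      (z ∗ᴵ i) ∗ᴵ i         ≡⟨ cong (_∗ᴵ i) (∗ᴵ-non-commuting z ¬c) ⟩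
      conjP i z ∗ᴵ i        ≡⟨ ∗ᴵ-non-commuting (conjP i z) (λ c → ¬c (conjP-commutes⇒commutes z c)) ⟩
      conjP i (conjP i z)   ≡⟨ conjP-involutive z ⟩
      z                     ∎
    where open ≡-Reasoning

  -- for an involution z the two candidate values of z ∗ s_i always differ:
  -- at x = s_i z(i) the permutation z s_i takes the value i, but s_i z s_i the value i+1
  conjP≢rmul : ∀ z → IsInvolution z → conjP i z ≢ rmul z i
  conjP≢rmul z z-inv eq = lo≢hi i (trans (sym rmul-at-x) (trans (cong (λ v → lookup v x) (sym eq)) conjP-at-x))
    where
    x : Fin n
    x = s i (lookup z (lo i))
    z-sx : lookup z (s i x) ≡ lo i
    z-sx = trans (cong (lookup z) (s-involutive i _)) (z-inv (lo i))
    rmul-at-x : lookup (rmul z i) x ≡ lo i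
    rmul-at-x = trans (lookup-rmul i z x) z-sx
    conjP-at-x : lookup (conjP i z) x ≡ hi i
    conjP-at-x = trans (lookup-conjP i z x) (trans (cong (s i) z-sx) (s-lo i))

lookup-ext : ∀ {A : Set} {n} {u v : Vec A n} → (∀ x → lookup u x ≡ lookup v x) → u ≡ v
lookup-ext {u = u} {v} eq = trans (sym (tabulate∘lookup u)) (trans (tabulate-cong eq) (tabulate∘lookup v))

IsMatching : ∀ {n} → RawClan n → Set
IsMatching {n} γ = ∀ (x j : Fin n) → lookup γ x ≡ mt j → (¬ (j ≡ x)) × (lookup γ j ≡ mt x)

fx≢mt : ∀ {n σ} {j : Fin n} → fx σ ≢ mt j
fx≢mt ()

mt-injective : ∀ {n} {j k : Fin n} → mt {n} j ≡ mt k → j ≡ k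
mt-injective refl = refl

module _ {n : ℕ} (γ : RawClan n) where

  private
    lookup-ι : ∀ x → lookup (ι γ) x ≡ _
    lookup-ι x = lookup∘tabulate _ x

  ι-fixed : ∀ x {σ} → lookup γ x ≡ fx σ → lookup (ι γ) x ≡ x
  ι-fixed x eq with lookup γ x | lookup-ι x
  ι-fixed x refl | _ | ιx = ιx

  ι-matched : ∀ x {j} → lookup γ x ≡ mt j → lookup (ι γ) x ≡ j
  ι-matched x eq with lookup γ x | lookup-ι x
  ι-matched x refl | _ | ιx = ιx

  matched-injective : IsMatching γ → ∀ {x y j} → lookup γ x ≡ mt j → lookup γ y ≡ mt j → x ≡ y
  matched-injective M x↦j y↦j = mt-injective (trans (sym (proj₂ (M _ _ x↦j))) (proj₂ (M _ _ y↦j)))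

  ι-involution : IsMatching γ → IsInvolution (ι γ)
  ι-involution M x with lookup γ x in eq
  ... | fx σ = trans (cong (lookup (ι γ)) (ι-fixed x eq)) (ι-fixed x eq)
  ... | mt j = trans (cong (lookup (ι γ)) (ι-matched x eq)) (ι-matched j (proj₂ (M x j eq)))

ι-pointwise : ∀ {n} (γ δ : RawClan n) x → lookup δ x ≡ lookup γ x → lookup (ι δ) x ≡ lookup (ι γ) x
ι-pointwise γ δ x eq with lookup γ x in eq′
... | fx σ = trans (ι-fixed δ x eq) (sym (ι-fixed γ x eq′))
... | mt j = trans (ι-matched δ x eq) (sym (ι-matched γ x eq′))

module _ {n : ℕ} (i : Idx n) (γ : RawClan n) where

  private
    lookup-conjC : ∀ x → lookup (conjC i γ) x ≡ _
    lookup-conjC x = lookup∘tabulate _ x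

  conjC-fixed : ∀ x {σ} → lookup γ (s i x) ≡ fx σ → lookup (conjC i γ) x ≡ fx σ
  conjC-fixed x eq with lookup γ (s i x) | lookup-conjC x
  conjC-fixed x refl | _ | γx = γx

  conjC-matched : ∀ x {j} → lookup γ (s i x) ≡ mt j → lookup (conjC i γ) x ≡ mt (s i j)
  conjC-matched x eq with lookup γ (s i x) | lookup-conjC x
  conjC-matched x refl | _ | γx = γx

  ι-conjC : ι (conjC i γ) ≡ conjP i (ι γ)
  ι-conjC = lookup-ext ι-conjC-at
    where
    ι-conjC-at : ∀ x → lookup (ι (conjC i γ)) x ≡ lookup (conjP i (ι γ)) x
    ι-conjC-at x with lookup γ (s i x) in eq
    ... | fx σ = trans (ι-fixed (conjC i γ) x (conjC-fixed x eq))
      (sym (trans (lookup-conjP i (ι γ) x) (trans (cong (s i) (ι-fixed γ (s i x) eq)) (s-involutive i x))))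
    ... | mt j = trans (ι-matched (conjC i γ) x (conjC-matched x eq))
      (sym (trans (lookup-conjP i (ι γ) x) (cong (s i) (ι-matched γ (s i x) eq))))

  matching-conjC : IsMatching γ → IsMatching (conjC i γ)
  matching-conjC M x j eq with lookup γ (s i x) in γsx
  ... | fx σ = ⊥-elim (fx≢mt (trans (sym (conjC-fixed x γsx)) eq))
  ... | mt k with mt-injective (trans (sym (conjC-matched x γsx)) eq)
  ...   | refl = (λ sk≡x → proj₁ (M _ _ γsx) (s-injective i (trans sk≡x (sym (s-involutive i x)))))
               , trans (conjC-matched (s i k) (trans (cong (lookup γ) (s-involutive i k)) (proj₂ (M _ _ γsx))))
                       (cong mt (s-involutive i x))

conjC-involutive : ∀ {n} (i : Idx n) (γ : RawClan n) → conjC i (conjC i γ) ≡ γ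
conjC-involutive i γ = lookup-ext conjC-involutive-at
  where
  γ-s-s : ∀ x → lookup γ (s i (s i x)) ≡ lookup γ x
  γ-s-s x = cong (lookup γ) (s-involutive i x)
  conjC-involutive-at : ∀ x → lookup (conjC i (conjC i γ)) x ≡ lookup γ x
  conjC-involutive-at x with lookup γ x in eq
  ... | fx σ = conjC-fixed i (conjC i γ) x (conjC-fixed i γ (s i x) (trans (γ-s-s x) eq))
  ... | mt j = trans (conjC-matched i (conjC i γ) x (conjC-matched i γ (s i x) (trans (γ-s-s x) eq)))
                     (cong mt (s-involutive i j))

setPair : ∀ {n} → RawClan n → Idx n → Entry n → Entry n → RawClan n
setPair γ i e₁ e₂ = (γ [ lo i ]≔ e₁) [ hi i ]≔ e₂

join : ∀ {n} → RawClan n → Idx n → RawClan n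
join γ i = setPair γ i (mt (hi i)) (mt (lo i))

split : ∀ {n} → RawClan n → Idx n → Sign → Sign → RawClan n
split γ i a b = setPair γ i (fx a) (fx b)

module _ {n : ℕ} (γ : RawClan n) (i : Idx n) (e₁ e₂ : Entry n) where

  setPair-lo : lookup (setPair γ i e₁ e₂) (lo i) ≡ e₁
  setPair-lo = trans (lookup∘update′ (lo≢hi i) (γ [ lo i ]≔ e₁) e₂) (lookup∘update (lo i) γ e₁)

  setPair-hi : lookup (setPair γ i e₁ e₂) (hi i) ≡ e₂
  setPair-hi = lookup∘update (hi i) (γ [ lo i ]≔ e₁) e₂

  setPair-away : ∀ x → x ≢ lo i → x ≢ hi i → lookup (setPair γ i e₁ e₂) x ≡ lookup γ x
  setPair-away x x≢lo x≢hi = trans (lookup∘update′ x≢hi (γ [ lo i ]≔ e₁) e₂) (lookup∘update′ x≢lo γ e₁)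

setPair-restore : ∀ {n} (γ : RawClan n) (i : Idx n) e₁ e₂ →
  setPair (setPair γ i e₁ e₂) i (lookup γ (lo i)) (lookup γ (hi i)) ≡ γ
setPair-restore γ i e₁ e₂ = lookup-ext restore-at
  where
  δ : RawClan _
  δ = setPair γ i e₁ e₂
  restore-at : ∀ x → lookup (setPair δ i (lookup γ (lo i)) (lookup γ (hi i))) x ≡ lookup γ x
  restore-at x with position i x
  ... | at-lo refl = setPair-lo δ i _ _
  ... | at-hi refl = setPair-hi δ i _ _
  ... | away x≢lo x≢hi = trans (setPair-away δ i _ _ x x≢lo x≢hi) (setPair-away γ i e₁ e₂ x x≢lo x≢hi)

data Closed {n} (γ : RawClan n) (i : Idx n) : Set where
  fixed-pair   : ∀ a b → lookup γ (lo i) ≡ fx a → lookup γ (hi i) ≡ fx b → Closed γ i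
  matched-pair : lookup γ (lo i) ≡ mt (hi i) → lookup γ (hi i) ≡ mt (lo i) → Closed γ i

module _ {n : ℕ} {γ : RawClan n} {i : Idx n} where

  closed-lo : Closed γ i → ∀ {y} → lookup γ (lo i) ≡ mt y → y ≡ hi i
  closed-lo (fixed-pair a b lo-fx _) lo↦y = ⊥-elim (fx≢mt (trans (sym lo-fx) lo↦y))
  closed-lo (matched-pair lo↦hi _) lo↦y = mt-injective (trans (sym lo↦y) lo↦hi)

  closed-hi : Closed γ i → ∀ {y} → lookup γ (hi i) ≡ mt y → y ≡ lo i
  closed-hi (fixed-pair a b _ hi-fx) hi↦y = ⊥-elim (fx≢mt (trans (sym hi-fx) hi↦y))
  closed-hi (matched-pair _ hi↦lo) hi↦y = mt-injective (trans (sym hi↦y) hi↦lo)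

  matched-away : IsMatching γ → Closed γ i → ∀ x j → x ≢ lo i → x ≢ hi i → lookup γ x ≡ mt j →
    (j ≢ lo i) × (j ≢ hi i)
  matched-away M C x j x≢lo x≢hi x↦j =
    (λ { refl → x≢hi (closed-lo C (proj₂ (M x j x↦j))) }) , (λ { refl → x≢lo (closed-hi C (proj₂ (M x j x↦j))) })

  ι-away : IsMatching γ → Closed γ i → ∀ x → x ≢ lo i → x ≢ hi i → (lookup (ι γ) x ≢ lo i) × (lookup (ι γ) x ≢ hi i)
  ι-away M C x x≢lo x≢hi with lookup γ x in eq
  ... | fx σ rewrite ι-fixed γ x eq = x≢lo , x≢hi
  ... | mt j rewrite ι-matched γ x eq = matched-away M C x j x≢lo x≢hi eq

  closed-commutes : IsMatching γ → Closed γ i → Commutes i (ι γ)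
  closed-commutes M C x with position i x
  closed-commutes M (fixed-pair a b lo-fx hi-fx) x | at-lo refl =
    trans (cong (s i) (ι-fixed γ _ lo-fx)) (trans (s-lo i) (sym (trans (cong (lookup (ι γ)) (s-lo i)) (ι-fixed γ _ hi-fx))))
  closed-commutes M (fixed-pair a b lo-fx hi-fx) x | at-hi refl =
    trans (cong (s i) (ι-fixed γ _ hi-fx)) (trans (s-hi i) (sym (trans (cong (lookup (ι γ)) (s-hi i)) (ι-fixed γ _ lo-fx))))
  closed-commutes M (matched-pair lo↦hi hi↦lo) x | at-lo refl =
    trans (cong (s i) (ι-matched γ _ lo↦hi)) (trans (s-hi i) (sym (trans (cong (lookup (ι γ)) (s-lo i)) (ι-matched γ _ hi↦lo))))
  closed-commutes M (matched-pair lo↦hi hi↦lo) x | at-hi refl =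
    trans (cong (s i) (ι-matched γ _ hi↦lo)) (trans (s-lo i) (sym (trans (cong (lookup (ι γ)) (s-hi i)) (ι-matched γ _ lo↦hi))))
  closed-commutes M C x | away x≢lo x≢hi =
    trans (s-other i _ (proj₁ ιx-away) (proj₂ ιx-away)) (cong (lookup (ι γ)) (sym (s-other i x x≢lo x≢hi)))
    where
    ιx-away : (lookup (ι γ) x ≢ lo i) × (lookup (ι γ) x ≢ hi i)
    ιx-away = ι-away M C x x≢lo x≢hi

module _ {n : ℕ} (γ : RawClan n) (i : Idx n) (e₁ e₂ : Entry n) where

  matching-setPair : IsMatching γ → Closed γ i → Closed (setPair γ i e₁ e₂) i → IsMatching (setPair γ i e₁ e₂)
  matching-setPair M C C′ x j x↦j with position i x
  ... | at-lo refl with closed-lo C′ x↦j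
  ...   | refl = (λ hi≡lo → lo≢hi i (sym hi≡lo)) , hi-to-lo C′
    where
    hi-to-lo : Closed (setPair γ i e₁ e₂) i → lookup (setPair γ i e₁ e₂) (hi i) ≡ mt (lo i)
    hi-to-lo (fixed-pair a b lo-fx _) = ⊥-elim (fx≢mt (trans (sym lo-fx) x↦j))
    hi-to-lo (matched-pair _ hi↦lo) = hi↦lo
  matching-setPair M C C′ x j x↦j | at-hi refl with closed-hi C′ x↦j
  ...   | refl = lo≢hi i , lo-to-hi C′
    where
    lo-to-hi : Closed (setPair γ i e₁ e₂) i → lookup (setPair γ i e₁ e₂) (lo i) ≡ mt (hi i)
    lo-to-hi (fixed-pair a b _ hi-fx) = ⊥-elim (fx≢mt (trans (sym hi-fx) x↦j))
    lo-to-hi (matched-pair lo↦hi _) = lo↦hi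
  matching-setPair M C C′ x j x↦j | away x≢lo x≢hi =
    proj₁ (M x j γx↦j) , trans (setPair-away γ i e₁ e₂ j (proj₁ j-away) (proj₂ j-away)) (proj₂ (M x j γx↦j))
    where
    γx↦j : lookup γ x ≡ mt j
    γx↦j = trans (sym (setPair-away γ i e₁ e₂ x x≢lo x≢hi)) x↦j
    j-away : (j ≢ lo i) × (j ≢ hi i)
    j-away = matched-away M C x j x≢lo x≢hi γx↦j

  ι-setPair : lookup (ι (setPair γ i e₁ e₂)) (lo i) ≡ lookup (ι γ) (hi i) →
    lookup (ι (setPair γ i e₁ e₂)) (hi i) ≡ lookup (ι γ) (lo i) → ι (setPair γ i e₁ e₂) ≡ rmul (ι γ) i
  ι-setPair at-lo-eq at-hi-eq = lookup-ext ι-setPair-at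
    where
    ι-setPair-at : ∀ x → lookup (ι (setPair γ i e₁ e₂)) x ≡ lookup (rmul (ι γ) i) x
    ι-setPair-at x with position i x
    ... | at-lo refl = trans at-lo-eq (sym (trans (lookup-rmul i (ι γ) (lo i)) (cong (lookup (ι γ)) (s-lo i))))
    ... | at-hi refl = trans at-hi-eq (sym (trans (lookup-rmul i (ι γ) (hi i)) (cong (lookup (ι γ)) (s-hi i))))
    ... | away x≢lo x≢hi = trans (ι-pointwise γ (setPair γ i e₁ e₂) x (setPair-away γ i e₁ e₂ x x≢lo x≢hi))
      (sym (trans (lookup-rmul i (ι γ) x) (cong (lookup (ι γ)) (s-other i x x≢lo x≢hi))))

module _ {n : ℕ} (γ : RawClan n) (i : Idx n) where

  join-closed : Closed (join γ i) i
  join-closed = matched-pair (setPair-lo γ i _ _) (setPair-hi γ i _ _)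

  split-closed : ∀ a b → Closed (split γ i a b) i
  split-closed a b = fixed-pair a b (setPair-lo γ i _ _) (setPair-hi γ i _ _)

  ι-join : ∀ {a b} → lookup γ (lo i) ≡ fx a → lookup γ (hi i) ≡ fx b → ι (join γ i) ≡ rmul (ι γ) i
  ι-join lo-fx hi-fx = ι-setPair γ i _ _
    (trans (ι-matched (join γ i) (lo i) (setPair-lo γ i _ _)) (sym (ι-fixed γ (hi i) hi-fx)))
    (trans (ι-matched (join γ i) (hi i) (setPair-hi γ i _ _)) (sym (ι-fixed γ (lo i) lo-fx)))

  ι-split : ∀ a b → lookup γ (lo i) ≡ mt (hi i) → lookup γ (hi i) ≡ mt (lo i) → ι (split γ i a b) ≡ rmul (ι γ) i
  ι-split a b lo↦hi hi↦lo = ι-setPair γ i _ _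
    (trans (ι-fixed (split γ i a b) (lo i) (setPair-lo γ i _ _)) (sym (ι-matched γ (hi i) hi↦lo)))
    (trans (ι-fixed (split γ i a b) (hi i) (setPair-hi γ i _ _)) (sym (ι-matched γ (lo i) lo↦hi)))

  join-split : ∀ a b → lookup γ (lo i) ≡ mt (hi i) → lookup γ (hi i) ≡ mt (lo i) → join (split γ i a b) i ≡ γ
  join-split a b lo↦hi hi↦lo rewrite sym lo↦hi | sym hi↦lo = setPair-restore γ i (fx a) (fx b)

  split-join : ∀ {a b} → lookup γ (lo i) ≡ fx a → lookup γ (hi i) ≡ fx b → γ ≡ split (join γ i) i a b
  split-join lo-fx hi-fx rewrite sym lo-fx | sym hi-fx = sym (setPair-restore γ i (mt (hi i)) (mt (lo i)))

data OppositeSigns {n} (γ : RawClan n) (i : Idx n) : Set where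
  opposite : ∀ a b → lookup γ (lo i) ≡ fx a → lookup γ (hi i) ≡ fx b → a ≢ b → OppositeSigns γ i

data Generic {n} (γ : RawClan n) (i : Idx n) : Set where
  fixed-matched : ∀ a k → lookup γ (lo i) ≡ fx a → lookup γ (hi i) ≡ mt k → Generic γ i
  matched-out   : ∀ j → lookup γ (lo i) ≡ mt j → j ≢ hi i → Generic γ i

data Configuration {n} (γ : RawClan n) (i : Idx n) : Set where
  closed  : Closed γ i → Configuration γ i
  generic : Generic γ i → Configuration γ i

module _ {n : ℕ} (γ : RawClan n) (i : Idx n) where

  configuration : IsMatching γ → Configuration γ i
  configuration M with lookup γ (lo i) in lo-eq | lookup γ (hi i) in hi-eq
  ... | fx a | fx b = closed (fixed-pair a b lo-eq hi-eq)
  ... | fx a | mt k = generic (fixed-matched a k lo-eq hi-eq)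
  ... | mt j | _ with j ≟ hi i
  ...   | yes refl = closed (matched-pair lo-eq (proj₂ (M _ _ lo-eq)))
  ...   | no j≢hi = generic (matched-out j lo-eq j≢hi)

  ∗ᶜ-cases : ∀ δ → γ ∗ᶜ i ≡ just δ → (OppositeSigns γ i × δ ≡ join γ i) ⊎ (Generic γ i × δ ≡ conjC i γ)
  ∗ᶜ-cases δ eq with lookup γ (lo i) in lo-eq | lookup γ (hi i) in hi-eq
  ... | fx a | fx b with a ≟ˢ b
  ...   | no a≢b = inj₁ (opposite a b lo-eq hi-eq a≢b , sym (just-injective eq))
  ∗ᶜ-cases δ () | fx a | fx b | yes _
  ∗ᶜ-cases δ eq | fx a | mt k = inj₂ (fixed-matched a k lo-eq hi-eq , sym (just-injective eq))
  ∗ᶜ-cases δ eq | mt j | _ with j ≟ hi i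
  ...   | no j≢hi = inj₂ (matched-out j lo-eq j≢hi , sym (just-injective eq))
  ∗ᶜ-cases δ () | mt j | _ | yes _

  ∗ᶜ-join : OppositeSigns γ i → γ ∗ᶜ i ≡ just (join γ i)
  ∗ᶜ-join (opposite a b lo-fx hi-fx a≢b) with lookup γ (lo i) | lookup γ (hi i)
  ∗ᶜ-join (opposite a b refl refl a≢b) | _ | _ with a ≟ˢ b
  ... | yes a≡b = ⊥-elim (a≢b a≡b)
  ... | no _ = refl

  ∗ᶜ-generic : Generic γ i → γ ∗ᶜ i ≡ just (conjC i γ)
  ∗ᶜ-generic (fixed-matched a k lo-fx hi↦k) with lookup γ (lo i) | lookup γ (hi i)
  ∗ᶜ-generic (fixed-matched a k refl refl) | _ | _ = refl
  ∗ᶜ-generic (matched-out j lo↦j j≢hi) with lookup γ (lo i)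
  ∗ᶜ-generic (matched-out j refl j≢hi) | _ with j ≟ hi i
  ... | yes j≡hi = ⊥-elim (j≢hi j≡hi)
  ... | no _ = refl

  generic-not-paired : Generic γ i → lookup γ (lo i) ≢ mt (hi i)
  generic-not-paired (fixed-matched a k lo-fx _) lo↦hi = fx≢mt (trans (sym lo-fx) lo↦hi)
  generic-not-paired (matched-out j lo↦j j≢hi) lo↦hi = j≢hi (mt-injective (trans (sym lo↦j) lo↦hi))

  generic-twisted : IsMatching γ → Generic γ i → s i (lookup (ι γ) (hi i)) ≢ lookup (ι γ) (lo i)
  generic-twisted M (fixed-matched a k lo-fx hi↦k) eq = proj₁ (M _ _ hi↦k) k≡hi
    where
    sk≡lo : s i k ≡ lo i
    sk≡lo = trans (cong (s i) (sym (ι-matched γ _ hi↦k))) (trans eq (ι-fixed γ _ lo-fx))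
    k≡hi : k ≡ hi i
    k≡hi = trans (sym (s-involutive i k)) (trans (cong (s i) sk≡lo) (s-lo i))
  generic-twisted M (matched-out j lo↦j j≢hi) eq with lookup γ (hi i) in hi-eq
  ... | fx b = proj₁ (M _ _ lo↦j) (trans (sym shi≡j) (s-hi i))
    where
    shi≡j : s i (hi i) ≡ j
    shi≡j = trans (cong (s i) (sym (ι-fixed γ _ hi-eq))) (trans eq (ι-matched γ _ lo↦j))
  ... | mt k with position i k
  ...   | at-lo refl = j≢hi (mt-injective (trans (sym lo↦j) (proj₂ (M _ _ hi-eq))))
  ...   | at-hi refl = proj₁ (M _ _ hi-eq) refl
  ...   | away k≢lo k≢hi = lo≢hi i (matched-injective γ M lo↦j (subst (λ u → lookup γ (hi i) ≡ mt u) k≡j hi-eq))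
    where
    k≡j : k ≡ j
    k≡j = trans (sym (s-other i k k≢lo k≢hi))
            (trans (cong (s i) (sym (ι-matched γ _ hi-eq))) (trans eq (ι-matched γ _ lo↦j)))

  generic-not-commuting : IsMatching γ → Generic γ i → ¬ Commutes i (ι γ)
  generic-not-commuting M g c = generic-twisted M g (trans (c (hi i)) (cong (lookup (ι γ)) (s-hi i)))

  generic-conjC : IsMatching γ → Generic γ i → Generic (conjC i γ) i
  generic-conjC M (fixed-matched a k lo-fx hi↦k) =
    matched-out (s i k) (conjC-matched i γ (lo i) (trans (cong (lookup γ) (s-lo i)) hi↦k)) sk≢hi
    where
    sk≢hi : s i k ≢ hi i
    sk≢hi sk≡hi = fx≢mt (trans (sym lo-fx) (subst (λ u → lookup γ u ≡ mt (hi i)) k≡lo (proj₂ (M _ _ hi↦k))))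
      where
      k≡lo : k ≡ lo i
      k≡lo = trans (sym (s-involutive i k)) (trans (cong (s i) sk≡hi) (s-hi i))
  generic-conjC M (matched-out j lo↦j j≢hi) with lookup γ (hi i) in hi-eq
  ... | fx b = fixed-matched b (s i j) (conjC-fixed i γ (lo i) (trans (cong (lookup γ) (s-lo i)) hi-eq))
                                       (conjC-matched i γ (hi i) (trans (cong (lookup γ) (s-hi i)) lo↦j))
  ... | mt k = matched-out (s i k) (conjC-matched i γ (lo i) (trans (cong (lookup γ) (s-lo i)) hi-eq)) sk≢hi
    where
    sk≢hi : s i k ≢ hi i
    sk≢hi sk≡hi = j≢hi (mt-injective (trans (sym lo↦j) (subst (λ u → lookup γ u ≡ mt (hi i)) k≡lo (proj₂ (M _ _ hi-eq)))))
      where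
      k≡lo : k ≡ lo i
      k≡lo = trans (sym (s-involutive i k)) (trans (cong (s i) sk≡hi) (s-hi i))

signCount : ∀ {n} → Sign → Entry n → ℕ
signCount σ (fx τ) = if does (σ ≟ˢ τ) then 1 else 0
signCount σ (mt _) = 0

opposite-signCount : ∀ {n} σ {a b} → a ≢ b → signCount {n} σ (fx a) + signCount {n} σ (fx b) ≡ 1
opposite-signCount σ {plus} {plus} a≢b = ⊥-elim (a≢b refl)
opposite-signCount σ {minus} {minus} a≢b = ⊥-elim (a≢b refl)
opposite-signCount plus {plus} {minus} _ = refl
opposite-signCount minus {plus} {minus} _ = refl
opposite-signCount plus {minus} {plus} _ = refl
opposite-signCount minus {minus} {plus} _ = refl

module _ {n : ℕ} (σ : Sign) where

  countSign-∷ : ∀ {m} (e : Entry n) (v : Vec (Entry n) m) → countSign σ (e ∷ v) ≡ signCount σ e + countSign σ v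
  countSign-∷ (fx τ) v = refl
  countSign-∷ (mt j) v = refl

  countSign-sum : ∀ {m} (v : Vec (Entry n) m) → countSign σ v ≡ sum (λ x → signCount σ (lookup v x))
  countSign-sum [] = refl
  countSign-sum (e ∷ v) = trans (countSign-∷ e v) (cong (signCount σ e +_) (countSign-sum v))

  countSign-update : ∀ {m} (v : Vec (Entry n) m) k e →
    countSign σ (v [ k ]≔ e) + signCount σ (lookup v k) ≡ countSign σ v + signCount σ e
  countSign-update (a ∷ v) F.zero e rewrite countSign-∷ e v | countSign-∷ a v = rearrange (signCount σ e) (countSign σ v) (signCount σ a)
    where
    rearrange : ∀ x y z → x + y + z ≡ z + y + x
    rearrange = solve-∀
  countSign-update (a ∷ v) (F.suc k) e rewrite countSign-∷ a (v [ k ]≔ e) | countSign-∷ a v =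
    trans (ℕP.+-assoc (signCount σ a) _ _)
      (trans (cong (signCount σ a +_) (countSign-update v k e)) (sym (ℕP.+-assoc (signCount σ a) _ _)))

  countSign-setPair : ∀ (γ : RawClan n) i e₁ e₂ →
    countSign σ (setPair γ i e₁ e₂) + (signCount σ (lookup γ (lo i)) + signCount σ (lookup γ (hi i)))
      ≡ countSign σ γ + (signCount σ e₁ + signCount σ e₂)
  countSign-setPair γ i e₁ e₂ = begin
      countSign σ δ + (c (lookup γ (lo i)) + c (lookup γ (hi i)))
        ≡⟨ cong (λ u → countSign σ δ + (c (lookup γ (lo i)) + c u)) (sym (lookup∘update′ (λ hi≡lo → lo≢hi i (sym hi≡lo)) γ e₁)) ⟩
      countSign σ δ + (c (lookup γ (lo i)) + c (lookup γ₁ (hi i)))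
        ≡⟨ rearrange (countSign σ δ) (c (lookup γ (lo i))) (c (lookup γ₁ (hi i))) ⟩
      (countSign σ δ + c (lookup γ₁ (hi i))) + c (lookup γ (lo i))
        ≡⟨ cong (_+ c (lookup γ (lo i))) (countSign-update γ₁ (hi i) e₂) ⟩
      (countSign σ γ₁ + c e₂) + c (lookup γ (lo i))
        ≡⟨ rearrange′ (countSign σ γ₁) (c e₂) (c (lookup γ (lo i))) ⟩
      (countSign σ γ₁ + c (lookup γ (lo i))) + c e₂
        ≡⟨ cong (_+ c e₂) (countSign-update γ (lo i) e₁) ⟩
      (countSign σ γ + c e₁) + c e₂
        ≡⟨ ℕP.+-assoc (countSign σ γ) _ _ ⟩
      countSign σ γ + (c e₁ + c e₂) ∎
    where
    open ≡-Reasoning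
    c : Entry n → ℕ
    c = signCount σ
    γ₁ δ : RawClan n
    γ₁ = γ [ lo i ]≔ e₁
    δ = setPair γ i e₁ e₂
    rearrange : ∀ x y z → x + (y + z) ≡ (x + z) + y
    rearrange = solve-∀
    rearrange′ : ∀ x y z → (x + y) + z ≡ (x + z) + y
    rearrange′ = solve-∀

  countSign-conjC : ∀ (i : Idx n) (γ : RawClan n) → countSign σ (conjC i γ) ≡ countSign σ γ
  countSign-conjC i γ = begin
      countSign σ (conjC i γ)                            ≡⟨ countSign-sum (conjC i γ) ⟩
      sum (λ x → signCount σ (lookup (conjC i γ) x))     ≡⟨ sum-cong-≗ relabel ⟩
      sum (λ x → signCount σ (lookup γ (s i x)))         ≡⟨ sum-involution (s i) (s-involutive i) (λ x → signCount σ (lookup γ x)) ⟩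
      sum (λ x → signCount σ (lookup γ x))               ≡⟨ sym (countSign-sum γ) ⟩
      countSign σ γ                                      ∎
    where
    open ≡-Reasoning
    relabel : ∀ x → signCount σ (lookup (conjC i γ) x) ≡ signCount σ (lookup γ (s i x))
    relabel x with lookup γ (s i x) in eq
    ... | fx τ = cong (signCount σ) (conjC-fixed i γ x eq)
    ... | mt j = cong (signCount σ) (conjC-matched i γ x eq)

  join-countSign : ∀ (γ : RawClan n) i → OppositeSigns γ i → countSign σ (join γ i) + 1 ≡ countSign σ γ
  join-countSign γ i (opposite a b lo-fx hi-fx a≢b) = begin
      countSign σ (join γ i) + 1
        ≡⟨ cong (countSign σ (join γ i) +_) (sym (opposite-signCount {n} σ a≢b)) ⟩
      countSign σ (join γ i) + (signCount σ (fx {n} a) + signCount σ (fx {n} b))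
        ≡⟨ cong₂ (λ u v → countSign σ (join γ i) + (signCount σ u + signCount σ v)) (sym lo-fx) (sym hi-fx) ⟩
      countSign σ (join γ i) + (signCount σ (lookup γ (lo i)) + signCount σ (lookup γ (hi i)))
        ≡⟨ countSign-setPair γ i (mt (hi i)) (mt (lo i)) ⟩
      countSign σ γ + 0
        ≡⟨ ℕP.+-identityʳ (countSign σ γ) ⟩
      countSign σ γ ∎
    where open ≡-Reasoning

  split-countSign : ∀ (γ : RawClan n) i a b → a ≢ b → lookup γ (lo i) ≡ mt (hi i) → lookup γ (hi i) ≡ mt (lo i) →
    countSign σ (split γ i a b) ≡ countSign σ γ + 1
  split-countSign γ i a b a≢b lo↦hi hi↦lo = begin
      countSign σ (split γ i a b)
        ≡⟨ sym (ℕP.+-identityʳ (countSign σ (split γ i a b))) ⟩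
      countSign σ (split γ i a b) + 0
        ≡⟨ cong₂ (λ u v → countSign σ (split γ i a b) + (signCount σ u + signCount σ v)) (sym lo↦hi) (sym hi↦lo) ⟩
      countSign σ (split γ i a b) + (signCount σ (lookup γ (lo i)) + signCount σ (lookup γ (hi i)))
        ≡⟨ countSign-setPair γ i (fx a) (fx b) ⟩
      countSign σ γ + (signCount σ (fx {n} a) + signCount σ (fx {n} b))
        ≡⟨ cong (countSign σ γ +_) (opposite-signCount {n} σ a≢b) ⟩
      countSign σ γ + 1 ∎
    where open ≡-Reasoning

private
  +-shift : ∀ a b k → (a + k) + b ≡ k + (a + b)
  +-shift = solve-∀

balance-+ : ∀ P M p q k → P + q ≡ M + p → (P + k) + q ≡ (M + k) + p
balance-+ P M p q k e = trans (+-shift P q k) (trans (cong (k +_) e) (sym (+-shift M p k)))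

balance-∸ : ∀ P M p q k → (P + k) + q ≡ (M + k) + p → P + q ≡ M + p
balance-∸ P M p q k e = ℕP.+-cancelˡ-≡ k _ _ (trans (sym (+-shift P q k)) (trans e (+-shift M p k)))

module _ {p q : ℕ} (i : Idx (p + q)) (γ : RawClan (p + q)) where

  isClan-conjC : IsClan p q γ → IsClan p q (conjC i γ)
  isClan-conjC (M , balanced) = matching-conjC i γ M ,
    subst₂ (λ P M → P + q ≡ M + p) (sym (countSign-conjC plus i γ)) (sym (countSign-conjC minus i γ)) balanced

  isClan-join : IsClan p q γ → OppositeSigns γ i → IsClan p q (join γ i)
  isClan-join (M , balanced) opp@(opposite a b lo-fx hi-fx _) =
    matching-setPair γ i (mt (hi i)) (mt (lo i)) M (fixed-pair a b lo-fx hi-fx) (join-closed γ i) ,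
    balance-∸ (countSign plus (join γ i)) (countSign minus (join γ i)) p q 1 (subst₂ (λ P M → P + q ≡ M + p) (sym (join-countSign plus γ i opp)) (sym (join-countSign minus γ i opp)) balanced)

  isClan-split : IsClan p q γ → ∀ a b → a ≢ b → lookup γ (lo i) ≡ mt (hi i) → lookup γ (hi i) ≡ mt (lo i) →
    IsClan p q (split γ i a b)
  isClan-split (M , balanced) a b a≢b lo↦hi hi↦lo =
    matching-setPair γ i (fx a) (fx b) M (matched-pair lo↦hi hi↦lo) (split-closed γ i a b) ,
    subst₂ (λ P M → P + q ≡ M + p) (sym (split-countSign plus γ i a b a≢b lo↦hi hi↦lo))
      (sym (split-countSign minus γ i a b a≢b lo↦hi hi↦lo)) (balance-+ (countSign plus γ) (countSign minus γ) p q 1 balanced)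

  isClan-∗ᶜ : IsClan p q γ → ∀ δ → γ ∗ᶜ i ≡ just δ → IsClan p q δ
  isClan-∗ᶜ C δ eq with ∗ᶜ-cases γ i δ eq
  ... | inj₁ (opp , refl) = isClan-join C opp
  ... | inj₂ (_ , refl) = isClan-conjC C

ι-∗ᶜ : ∀ {n} (γ : RawClan n) (i : Idx n) → IsMatching γ → ∀ δ → γ ∗ᶜ i ≡ just δ → ι δ ≡ ι γ ∗ᴵ i
ι-∗ᶜ γ i M δ eq with ∗ᶜ-cases γ i δ eq
... | inj₁ (opposite a b lo-fx hi-fx _ , refl) = begin
    ι (join γ i)    ≡⟨ ι-join γ i lo-fx hi-fx ⟩
    rmul (ι γ) i    ≡⟨ sym (∗ᴵ-commuting i (ι γ) (closed-commutes {γ = γ} {i = i} M (fixed-pair a b lo-fx hi-fx))) ⟩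
    ι γ ∗ᴵ i        ∎
  where open ≡-Reasoning
... | inj₂ (g , refl) = begin
    ι (conjC i γ)   ≡⟨ ι-conjC i γ ⟩
    conjP i (ι γ)   ≡⟨ sym (∗ᴵ-non-commuting i (ι γ) (generic-not-commuting γ i M g)) ⟩
    ι γ ∗ᴵ i        ∎
  where open ≡-Reasoning

ι-∗ᶜ-undo : ∀ {n} (γ : RawClan n) (i : Idx n) → IsMatching γ → ∀ δ → γ ∗ᶜ i ≡ just δ → ι δ ∗ᴵ i ≡ ι γ
ι-∗ᶜ-undo γ i M δ eq = trans (cong (_∗ᴵ i) (ι-∗ᶜ γ i M δ eq)) (∗ᴵ-involutive i (ι γ))

ℓ-increases : ∀ {n} {δ γ : RawClan n} → δ <ᶜ γ → ℓ (ι γ) < ℓ (ι δ)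
ℓ-increases [ _ , _ , ℓ< ] = ℓ<
ℓ-increases ((_ , _ , ℓ<) ∷ rest) = ℕP.<-trans (ℓ-increases rest) ℓ<

ι-cover : ∀ {n} {δ γ : RawClan n} → IsMatching γ → ClanCover δ γ → InvCover (ι γ) (ι δ)
ι-cover {γ = γ} M (i , eq , ℓ<) = i , ι-∗ᶜ-undo γ i M _ eq , ℓ<

ι-reverses : ∀ {p q} {δ γ : RawClan (p + q)} → δ <ᶜ γ → IsClan p q γ → IsClan p q δ × (ι γ <ᴵ ι δ)
ι-reverses {p} {q} {δ} {γ} [ cover@(i , eq , _) ] C =
  isClan-∗ᶜ {p} {q} i γ C δ eq , [ ι-cover {δ = δ} {γ = γ} (proj₁ C) cover ]
ι-reverses {p} {q} {δ} (_∷_ {y = μ} cover@(i , eq , _) rest) C with ι-reverses rest C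
... | Cμ , γ<μ = isClan-∗ᶜ {p} {q} i μ Cμ δ eq , γ<μ ++ [ ι-cover {δ = δ} {γ = μ} (proj₁ Cμ) cover ]

module CoversAtDescent {p q : ℕ} (γ : RawClan (p + q)) (C : IsClan p q γ) (i : Idx (p + q))
  (desc : Descent i (ι γ)) where

  private
    z : Perm (p + q)
    z = ι γ
    M : IsMatching γ
    M = proj₁ C
    z-inv : IsInvolution z
    z-inv = ι-involution γ M

  CoversVia : RawClan (p + q) → Set
  CoversVia γ′ = IsClan p q γ′ × γ <ᶜ γ′ × γ′ ∗ᶜ i ≡ just γ

  UniqueCover : Set
  UniqueCover = Σ (RawClan (p + q)) λ γ′ → CoversVia γ′
    × (∀ γ″ → IsClan p q γ″ → γ <ᶜ γ″ → γ″ ∗ᶜ i ≡ just γ → γ″ ≡ γ′)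

  TwoCovers : Set
  TwoCovers = Σ (RawClan (p + q)) λ γ₁ → Σ (RawClan (p + q)) λ γ₂ →
    ¬ (γ₁ ≡ γ₂) × CoversVia γ₁ × CoversVia γ₂
    × (∀ γ″ → IsClan p q γ″ → γ <ᶜ γ″ → γ″ ∗ᶜ i ≡ just γ → (γ″ ≡ γ₁) ⊎ (γ″ ≡ γ₂))

  no-fixed-pair : ∀ {a b} → lookup γ (lo i) ≡ fx a → lookup γ (hi i) ≡ fx b → ⊥
  no-fixed-pair lo-fx hi-fx = FP.<-asym (lo<hi i) (subst₂ _<ꟳ_ (ι-fixed γ _ hi-fx) (ι-fixed γ _ lo-fx) desc)

  module _ (g : Generic γ i) where

    conjC-covers : CoversVia (conjC i γ)
    conjC-covers = isClan-conjC {p} {q} i γ C , [ i , undo , ℓ< ] , undo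
      where
      undo : conjC i γ ∗ᶜ i ≡ just γ
      undo = trans (∗ᶜ-generic (conjC i γ) i (generic-conjC γ i M g)) (cong just (conjC-involutive i γ))
      ℓ< : ℓ (ι (conjC i γ)) < ℓ z
      ℓ< = subst (λ w → ℓ w < ℓ z) (sym (ι-conjC i γ)) (ℓ-conjP-< i z z-inv desc (generic-twisted γ i M g))

    conjC-unique : ∀ γ″ → γ″ ∗ᶜ i ≡ just γ → γ″ ≡ conjC i γ
    conjC-unique γ″ eq with ∗ᶜ-cases γ″ i γ eq
    ... | inj₁ (_ , γ≡join) = ⊥-elim (generic-not-paired γ i g (trans (cong (λ v → lookup v (lo i)) γ≡join) (setPair-lo γ″ i _ _)))
    ... | inj₂ (_ , γ≡conj) = trans (sym (conjC-involutive i γ″)) (cong (conjC i) (sym γ≡conj))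

    unique-cover : UniqueCover
    unique-cover = conjC i γ , conjC-covers , λ γ″ _ _ → conjC-unique γ″

  module _ (lo↦hi : lookup γ (lo i) ≡ mt (hi i)) (hi↦lo : lookup γ (hi i) ≡ mt (lo i)) where

    split-covers : ∀ a b → a ≢ b → CoversVia (split γ i a b)
    split-covers a b a≢b = isClan-split {p} {q} i γ C a b a≢b lo↦hi hi↦lo , [ i , undo , ℓ< ] , undo
      where
      undo : split γ i a b ∗ᶜ i ≡ just γ
      undo = trans (∗ᶜ-join (split γ i a b) i (opposite a b (setPair-lo γ i _ _) (setPair-hi γ i _ _) a≢b))
                   (cong just (join-split γ i a b lo↦hi hi↦lo))
      ℓ< : ℓ (ι (split γ i a b)) < ℓ z
      ℓ< = subst (λ w → ℓ w < ℓ z) (sym (ι-split γ i a b lo↦hi hi↦lo)) (ℓ-rmul-< i z desc)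

    splits-differ : split γ i plus minus ≢ split γ i minus plus
    splits-differ eq with trans (sym (setPair-lo γ i (fx plus) (fx minus)))
                            (trans (cong (λ v → lookup v (lo i)) eq) (setPair-lo γ i (fx minus) (fx plus)))
    ... | ()

    splits-unique : ∀ γ″ → IsMatching γ″ → γ″ ∗ᶜ i ≡ just γ → (γ″ ≡ split γ i plus minus) ⊎ (γ″ ≡ split γ i minus plus)
    splits-unique γ″ M″ eq with ∗ᶜ-cases γ″ i γ eq
    ... | inj₁ (opposite a b lo-fx hi-fx a≢b , refl) = by-signs a b a≢b (split-join γ″ i lo-fx hi-fx)
      where
      by-signs : ∀ a b → a ≢ b → γ″ ≡ split γ i a b → (γ″ ≡ split γ i plus minus) ⊎ (γ″ ≡ split γ i minus plus)
      by-signs plus plus a≢b _ = ⊥-elim (a≢b refl)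
      by-signs plus minus _ eq″ = inj₁ eq″
      by-signs minus plus _ eq″ = inj₂ eq″
      by-signs minus minus a≢b _ = ⊥-elim (a≢b refl)
    ... | inj₂ (g″ , γ≡conj) =
      ⊥-elim (generic-not-paired γ i (subst (λ δ → Generic δ i) (sym γ≡conj) (generic-conjC γ″ i M″ g″)) lo↦hi)

    two-covers : TwoCovers
    two-covers = split γ i plus minus , split γ i minus plus , splits-differ
      , split-covers plus minus (λ ()) , split-covers minus plus (λ ())
      , λ γ″ C″ _ → splits-unique γ″ (proj₁ C″)

  covers : (z ∗ᴵ i ≡ conjP i z → UniqueCover) × (z ∗ᴵ i ≡ rmul z i → TwoCovers)
  covers with configuration γ i M
  ... | closed (fixed-pair a b lo-fx hi-fx) = ⊥-elim (no-fixed-pair lo-fx hi-fx)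
  ... | closed P@(matched-pair lo↦hi hi↦lo) =
        (λ z∗s≡conj → ⊥-elim (conjP≢rmul i z z-inv (trans (sym z∗s≡conj) (∗ᴵ-commuting i z (closed-commutes {γ = γ} {i = i} M P)))))
      , (λ _ → two-covers lo↦hi hi↦lo)
  ... | generic g =
        (λ _ → unique-cover g)
      , (λ z∗s≡rmul → ⊥-elim (conjP≢rmul i z z-inv (trans (sym (∗ᴵ-non-commuting i z (generic-not-commuting γ i M g))) z∗s≡rmul)))

fixedCount : ∀ {n} → Perm n → ℕ
fixedCount z = sum (λ x → 𝟙 (does (lookup z x ≟ x)))

fixedCount+2κ : ∀ {n} (z : Perm n) → IsInvolution z → fixedCount z + (κ z + κ z) ≡ n
fixedCount+2κ {n} z z-inv = begin
    sum fixed + (κ z + κ z)                 ≡⟨ cong (λ k → sum fixed + (k + k)) κ-sum ⟩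
    sum fixed + (sum opens + sum opens)     ≡⟨ cong (λ k → sum fixed + (sum opens + k)) closes≡opens ⟨
    sum fixed + (sum opens + sum closes)    ≡⟨ cong (sum fixed +_) (∑-distrib-+ opens closes) ⟨
    sum fixed + sum (λ x → opens x + closes x)  ≡⟨ ∑-distrib-+ fixed (λ x → opens x + closes x) ⟨
    sum (λ x → fixed x + (opens x + closes x))  ≡⟨ sum-cong-≗ trichotomy ⟩
    sum {n} (λ _ → 1)                       ≡⟨ sum-ones n ⟩
    n                                       ∎
  where
  open ≡-Reasoning
  fixed opens closes : Fin n → ℕ
  fixed x = 𝟙 (does (lookup z x ≟ x))
  opens x = 𝟙 (does (x F.<? lookup z x))
  closes x = 𝟙 (does (lookup z x F.<? x))

  κ-sum : κ z ≡ sum opens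
  κ-sum = length-filter-tabulate (λ x → x) (λ x → x F.<? lookup z x)

  -- z maps the larger points of 2-cycles bijectively onto the smaller ones
  closes≡opens : sum closes ≡ sum opens
  closes≡opens = trans (sym (sum-involution (lookup z) z-inv closes))
    (sum-cong-≗ λ x → cong (λ y → 𝟙 (does (y F.<? lookup z x))) (z-inv x))

  trichotomy : ∀ x → fixed x + (opens x + closes x) ≡ 1
  trichotomy x with FP.<-cmp (lookup z x) x
  ... | tri< zx<x zx≢x _ rewrite 𝟙-no (lookup z x ≟ x) zx≢x | 𝟙-no (x F.<? lookup z x) (FP.<-asym zx<x)
                               | 𝟙-yes (lookup z x F.<? x) zx<x = refl
  ... | tri≈ _ zx≡x _ rewrite 𝟙-yes (lookup z x ≟ x) zx≡x | 𝟙-no (x F.<? lookup z x) (FP.<-irrefl (sym zx≡x))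
                               | 𝟙-no (lookup z x F.<? x) (FP.<-irrefl zx≡x) = refl
  ... | tri> _ zx≢x x<zx rewrite 𝟙-no (lookup z x ≟ x) zx≢x | 𝟙-yes (x F.<? lookup z x) x<zx
                               | 𝟙-no (lookup z x F.<? x) (FP.<-asym x<zx) = refl

countSigns≡fixedCount : ∀ {n} (γ : RawClan n) → IsMatching γ →
  countSign plus γ + countSign minus γ ≡ fixedCount (ι γ)
countSigns≡fixedCount {n} γ M = begin
    countSign plus γ + countSign minus γ
      ≡⟨ cong₂ _+_ (countSign-sum plus γ) (countSign-sum minus γ) ⟩
    sum (λ x → signCount plus (lookup γ x)) + sum (λ x → signCount minus (lookup γ x))
      ≡⟨ ∑-distrib-+ (λ x → signCount plus (lookup γ x)) (λ x → signCount minus (lookup γ x)) ⟨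
    sum (λ x → signCount plus (lookup γ x) + signCount minus (lookup γ x))
      ≡⟨ sum-cong-≗ signed≡fixed ⟩
    fixedCount (ι γ) ∎
  where
  open ≡-Reasoning
  signed≡fixed : ∀ x → signCount plus (lookup γ x) + signCount minus (lookup γ x) ≡ 𝟙 (does (lookup (ι γ) x ≟ x))
  signed≡fixed x with lookup γ x in eq
  ... | fx plus = sym (𝟙-yes (lookup (ι γ) x ≟ x) (ι-fixed γ x eq))
  ... | fx minus = sym (𝟙-yes (lookup (ι γ) x ≟ x) (ι-fixed γ x eq))
  ... | mt j = sym (𝟙-no (lookup (ι γ) x ≟ x) (λ ιx≡x → proj₁ (M x j eq) (trans (sym (ι-matched γ x eq)) ιx≡x)))

private
  double : ∀ x → 2 ℕ.* x ≡ x + x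
  double = solve-∀

  halve : ∀ x y → x + x ≡ y + y → x ≡ y
  halve x y e = ℕP.*-cancelˡ-≡ x y 2 (trans (double x) (trans e (sym (double y))))

cycles+plus≡p : ∀ K P M p q → P + M + (K + K) ≡ p + q → P + q ≡ M + p → K + P ≡ p
cycles+plus≡p K P M p q size balanced = halve (K + P) p (ℕP.+-cancelʳ-≡ (M + q) _ _ (begin
    (K + P) + (K + P) + (M + q)       ≡⟨ regroup K P M q ⟩
    (P + M + (K + K)) + (P + q)       ≡⟨ cong₂ _+_ size balanced ⟩
    (p + q) + (M + p)                 ≡⟨ regroup′ M p q ⟩
    (p + p) + (M + q)                 ∎))
  where
  open ≡-Reasoning
  regroup : ∀ K P M q → (K + P) + (K + P) + (M + q) ≡ (P + M + (K + K)) + (P + q)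
  regroup = solve-∀
  regroup′ : ∀ M p q → (p + q) + (M + p) ≡ (p + p) + (M + q)
  regroup′ = solve-∀

ι-image : ∀ p q (γ : RawClan (p + q)) → IsClan p q γ → IsInvolution (ι γ) × κ (ι γ) ≤ p ⊓ q
ι-image p q γ (M , balanced) = z-inv , ℕP.⊓-glb (subst (K ≤_) K+P≡p (ℕP.m≤m+n K P)) (subst (K ≤_) K+M≡q (ℕP.m≤m+n K Mi))
  where
  z-inv : IsInvolution (ι γ)
  z-inv = ι-involution γ M
  K P Mi : ℕ
  K = κ (ι γ)
  P = countSign plus γ
  Mi = countSign minus γ
  size : P + Mi + (K + K) ≡ p + q
  size = trans (cong (_+ (K + K)) (countSigns≡fixedCount γ M)) (fixedCount+2κ (ι γ) z-inv)
  K+P≡p : K + P ≡ p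
  K+P≡p = cycles+plus≡p K P Mi p q size balanced
  K+M≡q : K + Mi ≡ q
  K+M≡q = cycles+plus≡p K Mi P q p (trans (cong (_+ (K + K)) (ℕP.+-comm Mi P)) (trans size (ℕP.+-comm p q))) (sym balanced)

labelling-balances : ∀ K F p q → K ≤ p → K ≤ q → F + (K + K) ≡ p + q →
  (p ∸ K ≤ F) × (∀ M → M + (p ∸ K) ≡ F → (p ∸ K) + q ≡ M + p)
labelling-balances K F p q K≤p K≤q size
  rewrite sym (ℕP.m∸n+n≡m K≤p) | sym (ℕP.m∸n+n≡m K≤q) | ℕP.m+n∸n≡m (p ∸ K) K =
    balances (p ∸ K) (q ∸ K) size
  where
  -- with p = a + K and q = b + K the fixed points number F = a + b
  balances : ∀ a b → F + (K + K) ≡ (a + K) + (b + K) → (a ≤ F) × (∀ M → M + a ≡ F → a + (b + K) ≡ M + (a + K))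
  balances a b size′ = subst (a ≤_) (sym F≡a+b) (ℕP.m≤m+n a b) , λ M M+a≡F → swap-sides M (M≡b M M+a≡F)
    where
    regroup : ∀ a b K → (a + K) + (b + K) ≡ (a + b) + (K + K)
    regroup = solve-∀
    F≡a+b : F ≡ a + b
    F≡a+b = ℕP.+-cancelʳ-≡ (K + K) _ _ (trans size′ (regroup a b K))
    M≡b : ∀ M → M + a ≡ F → M ≡ b
    M≡b M M+a≡F = ℕP.+-cancelˡ-≡ a _ _ (trans (ℕP.+-comm a M) (trans M+a≡F F≡a+b))
    swap-sides : ∀ M → M ≡ b → a + (b + K) ≡ M + (a + K)
    swap-sides M refl = exchange a b K
      where
      exchange : ∀ a b K → a + (b + K) ≡ b + (a + K)
      exchange = solve-∀

entryFor : ∀ {n} {x y : Fin n} → Dec (y ≡ x) → Entry n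
entryFor (yes _) = fx minus
entryFor {y = y} (no _) = mt y

allMinus : ∀ {n} → Perm n → RawClan n
allMinus z = tabulate λ x → entryFor (lookup z x ≟ x)

module _ {n : ℕ} (z : Perm n) where

  data AllMinusEntry (x : Fin n) : Set where
    fixed-point : lookup z x ≡ x → lookup (allMinus z) x ≡ fx minus → AllMinusEntry x
    moved-point : lookup z x ≢ x → lookup (allMinus z) x ≡ mt (lookup z x) → AllMinusEntry x

  allMinus-entry : ∀ x → AllMinusEntry x
  allMinus-entry x with lookup z x ≟ x | lookup∘tabulate (λ y → entryFor (lookup z y ≟ y)) x
  ... | yes zx≡x | entry = fixed-point zx≡x entry
  ... | no zx≢x | entry = moved-point zx≢x entry

  ι-allMinus : ι (allMinus z) ≡ z
  ι-allMinus = lookup-ext λ x → ι-at x (allMinus-entry x)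
    where
    ι-at : ∀ x → AllMinusEntry x → lookup (ι (allMinus z)) x ≡ lookup z x
    ι-at x (fixed-point zx≡x entry) = trans (ι-fixed (allMinus z) x entry) (sym zx≡x)
    ι-at x (moved-point _ entry) = ι-matched (allMinus z) x entry

  allMinus-matching : IsInvolution z → IsMatching (allMinus z)
  allMinus-matching z-inv x j x↦j with allMinus-entry x
  ... | fixed-point _ entry = ⊥-elim (fx≢mt (trans (sym entry) x↦j))
  ... | moved-point zx≢x entry with mt-injective (trans (sym entry) x↦j)
  ...   | refl = zx≢x , partner (allMinus-entry (lookup z x))
    where
    partner : AllMinusEntry (lookup z x) → lookup (allMinus z) (lookup z x) ≡ mt x
    partner (fixed-point zzx≡zx _) = ⊥-elim (zx≢x (sym (trans (sym (z-inv x)) zzx≡zx)))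
    partner (moved-point _ entry′) = trans entry′ (cong mt (z-inv x))

isFixed : ∀ {n} → Entry n → ℕ
isFixed (fx _) = 1
isFixed (mt _) = 0

fixedEntries : ∀ {n m} → Vec (Entry n) m → ℕ
fixedEntries v = sum (λ x → isFixed (lookup v x))

fixedEntries-allMinus : ∀ {n} (z : Perm n) → fixedEntries (allMinus z) ≡ fixedCount z
fixedEntries-allMinus z = sum-cong-≗ λ x → at x (allMinus-entry z x)
  where
  at : ∀ x → AllMinusEntry z x → isFixed (lookup (allMinus z) x) ≡ 𝟙 (does (lookup z x ≟ x))
  at x (fixed-point zx≡x entry) = trans (cong isFixed entry) (sym (𝟙-yes (lookup z x ≟ x) zx≡x))
  at x (moved-point zx≢x entry) = trans (cong isFixed entry) (sym (𝟙-no (lookup z x ≟ x) zx≢x))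

relabel : ∀ {n m} → ℕ → Vec (Entry n) m → Vec (Entry n) m
relabel t [] = []
relabel t (mt j ∷ v) = mt j ∷ relabel t v
relabel zero (fx _ ∷ v) = fx minus ∷ relabel zero v
relabel (suc t) (fx _ ∷ v) = fx plus ∷ relabel t v

data SameShape {n} : Entry n → Entry n → Set where
  both-matched : ∀ j → SameShape (mt j) (mt j)
  both-fixed   : ∀ σ τ → SameShape (fx σ) (fx τ)

relabel-shape : ∀ {n m} t (v : Vec (Entry n) m) x → SameShape (lookup v x) (lookup (relabel t v) x)
relabel-shape t (mt j ∷ v) F.zero = both-matched j
relabel-shape zero (fx σ ∷ v) F.zero = both-fixed σ minus
relabel-shape (suc t) (fx σ ∷ v) F.zero = both-fixed σ plus
relabel-shape t (mt j ∷ v) (F.suc x) = relabel-shape t v x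
relabel-shape zero (fx σ ∷ v) (F.suc x) = relabel-shape zero v x
relabel-shape (suc t) (fx σ ∷ v) (F.suc x) = relabel-shape t v x

relabel-counts : ∀ {n m} t (v : Vec (Entry n) m) → t ≤ fixedEntries v →
  (countSign plus (relabel t v) ≡ t) × (countSign minus (relabel t v) + t ≡ fixedEntries v)
relabel-counts t [] z≤n = refl , refl
relabel-counts t (mt j ∷ v) t≤ = relabel-counts t v t≤
relabel-counts zero (fx σ ∷ v) _ with relabel-counts zero v z≤n
... | plus≡0 , minus+0≡F = plus≡0 , cong suc minus+0≡F
relabel-counts (suc t) (fx σ ∷ v) (s≤s t≤) with relabel-counts t v t≤
... | plus≡t , minus+t≡F = cong suc plus≡t , trans (ℕP.+-suc _ t) (cong suc minus+t≡F)

module _ {n : ℕ} (t : ℕ) (γ : RawClan n) where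

  relabel-matched : ∀ x {j} → lookup γ x ≡ mt j → lookup (relabel t γ) x ≡ mt j
  relabel-matched x eq with lookup γ x | lookup (relabel t γ) x | relabel-shape t γ x
  relabel-matched x refl | _ | _ | both-matched j = refl

  relabel-matched⁻¹ : ∀ x {j} → lookup (relabel t γ) x ≡ mt j → lookup γ x ≡ mt j
  relabel-matched⁻¹ x eq with lookup γ x | lookup (relabel t γ) x | relabel-shape t γ x
  relabel-matched⁻¹ x refl | _ | _ | both-matched j = refl

  relabel-fixed : ∀ x {σ} → lookup γ x ≡ fx σ → Σ Sign λ τ → lookup (relabel t γ) x ≡ fx τ
  relabel-fixed x eq with lookup γ x | lookup (relabel t γ) x | relabel-shape t γ x
  relabel-fixed x refl | _ | _ | both-fixed σ τ = τ , refl

  ι-relabel : ι (relabel t γ) ≡ ι γ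
  ι-relabel = lookup-ext ι-at
    where
    ι-at : ∀ x → lookup (ι (relabel t γ)) x ≡ lookup (ι γ) x
    ι-at x with lookup γ x in eq
    ... | fx σ = trans (ι-fixed (relabel t γ) x (proj₂ (relabel-fixed x eq))) (sym (ι-fixed γ x eq))
    ... | mt j = trans (ι-matched (relabel t γ) x (relabel-matched x eq)) (sym (ι-matched γ x eq))

  matching-relabel : IsMatching γ → IsMatching (relabel t γ)
  matching-relabel M x j x↦j with M x j (relabel-matched⁻¹ x x↦j)
  ... | j≢x , j↦x = j≢x , relabel-matched j j↦x

clan-with-involution : ∀ p q (z : Perm (p + q)) → IsInvolution z → κ z ≤ p ⊓ q →
  Σ (RawClan (p + q)) λ γ → IsClan p q γ × ι γ ≡ z
clan-with-involution p q z z-inv κ≤ = relabel t (allMinus z) , (matching , balanced) , involution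
  where
  K t : ℕ
  K = κ z
  t = p ∸ K
  labelling : (t ≤ fixedEntries (allMinus z)) × (∀ M → M + t ≡ fixedEntries (allMinus z) → t + q ≡ M + p)
  labelling = labelling-balances K (fixedEntries (allMinus z)) p q
    (ℕP.≤-trans κ≤ (ℕP.m⊓n≤m p q)) (ℕP.≤-trans κ≤ (ℕP.m⊓n≤n p q))
    (trans (cong (_+ (K + K)) (fixedEntries-allMinus z)) (fixedCount+2κ z z-inv))
  counts : (countSign plus (relabel t (allMinus z)) ≡ t)
         × (countSign minus (relabel t (allMinus z)) + t ≡ fixedEntries (allMinus z))
  counts = relabel-counts t (allMinus z) (proj₁ labelling)

  matching : IsMatching (relabel t (allMinus z))
  matching = matching-relabel t (allMinus z) (allMinus-matching z z-inv)

  balanced : countSign plus (relabel t (allMinus z)) + q ≡ countSign minus (relabel t (allMinus z)) + p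
  balanced = trans (cong (_+ q) (proj₁ counts)) (proj₂ labelling _ (proj₂ counts))

  involution : ι (relabel t (allMinus z)) ≡ z
  involution = trans (ι-relabel t (allMinus z)) (ι-allMinus z)

mainTheorem14 :
    (p q : ℕ) →
    ((γ : RawClan (p + q)) → IsClan p q γ → (i : Idx (p + q)) →
      (∀ δ → γ ∗ᶜ i ≡ just δ → ι δ ≡ ι γ ∗ᴵ i)
      × (∀ δ → γ ∗ᶜ i ≡ just δ → δ <ᶜ γ → ι γ <ᴵ ι δ)
      × (lookup (ι γ) (hi i) <ꟳ lookup (ι γ) (lo i) →
          (ι γ ∗ᴵ i ≡ conjP i (ι γ) →
             Σ (RawClan (p + q)) λ γ′ →
               (IsClan p q γ′ × γ <ᶜ γ′ × γ′ ∗ᶜ i ≡ just γ)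
               × (∀ γ″ → IsClan p q γ″ → γ <ᶜ γ″ → γ″ ∗ᶜ i ≡ just γ → γ″ ≡ γ′))
          × (ι γ ∗ᴵ i ≡ rmul (ι γ) i →
             Σ (RawClan (p + q)) λ γ₁ → Σ (RawClan (p + q)) λ γ₂ →
               ¬ (γ₁ ≡ γ₂)
               × (IsClan p q γ₁ × γ <ᶜ γ₁ × γ₁ ∗ᶜ i ≡ just γ)
               × (IsClan p q γ₂ × γ <ᶜ γ₂ × γ₂ ∗ᶜ i ≡ just γ)
               × (∀ γ″ → IsClan p q γ″ → γ <ᶜ γ″ → γ″ ∗ᶜ i ≡ just γ → (γ″ ≡ γ₁) ⊎ (γ″ ≡ γ₂)))))
    × (∀ (γ δ : RawClan (p + q)) → IsClan p q γ → IsClan p q δ → δ <ᶜ γ → ι γ <ᴵ ι δ)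
    × (∀ (z : Perm (p + q)) →
         (Σ (RawClan (p + q)) λ γ → IsClan p q γ × ι γ ≡ z)
           ⇔ (IsInvolution z × κ z ≤ p ⊓ q))
mainTheorem14 p q =
    (λ γ C i →
        ι-∗ᶜ γ i (proj₁ C)
      , (λ δ step below → [ i , ι-∗ᶜ-undo γ i (proj₁ C) δ step , ℓ-increases below ])
      , CoversAtDescent.covers γ C i)
  , (λ γ δ Cγ _ δ<γ → proj₂ (ι-reverses δ<γ Cγ))
  , (λ z → mk⇔ (λ { (γ , C , refl) → ι-image p q γ C })
               (λ (z-inv , κ≤) → clan-with-involution p q z z-inv κ≤))
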